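{- Let $r:V\times V\to\{0,1\}$ be a demand function with $\max_{u,v\in V} r(u,v)=1$. If an undirected edge set $H$ on $V$ satisfies $d_H(X)\ge f_r(X)$ for all $X\subseteq V$, then $H$ has an orientation $D$ such that $D$ contains a directed $uv$-path for every $(u,v)$ with $r(u,v)=1$.
   Context: For $X\subseteq V$, $\bar X=V\setminus X$ and $d_H(X)$ is the number of edges of $H$ with exactly one endpoint in $X$. The set function $f_r$ is defined by $f_r(\emptyset)=f_r(V)=0$ and, for $\emptyset\ne X\subsetneq V$, $f_r(X)=\max\{r(u,v):u\in X,v\in\bar X\}+\max\{r(v,u):u\in X,v\in\bar X\}$. -}

module Defs where

open import Data.Nat using (ℕ; zero; suc; _⊔_; _≤_)
open import Data.Bool using (Bool; true; false; _∧_; _∨_; not; _xor_; if_then_else_)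
open import Data.Fin using (Fin)
open import Data.List using (List; []; _∷_; map; foldr; allFin; concatMap)
open import Data.Nat.ListAction using (sum)
open import Data.List.Relation.Binary.Pointwise using (Pointwise)
open import Data.List.Membership.Propositional using (_∈_)
open import Data.Product using (_×_; _,_)
open import Data.Sum using (_⊎_)
open import Relation.Binary.PropositionalEquality using (_≡_)
open import Relation.Binary.Construct.Closure.ReflexiveTransitive using (Star)

Subset : ℕ → Set
Subset n = Fin n → Bool

-- Demand function r : V × V → {0,1}, with true = 1, false = 0.
Demand : ℕ → Set
Demand n = Fin n → Fin n → Bool

-- An undirected (multi)graph on V: a list of edges, each edge an unordered
-- pair written as an ordered pair.
Graph : ℕ → Set
Graph n = List (Fin n × Fin n)

b2n : Bool → ℕ
b2n true = 1
b2n false = 0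

d : ∀ {n} → Graph n → Subset n → ℕ
d H X = sum (map (λ { (x , y) → b2n (X x xor X y) }) H)

allPairs : ∀ n → List (Fin n × Fin n)
allPairs n = concatMap (λ u → map (λ v → (u , v)) (allFin n)) (allFin n)

anyFin : ∀ n → (Fin n → Bool) → Bool
anyFin n p = foldr _∨_ false (map p (allFin n))

allFinB : ∀ n → (Fin n → Bool) → Bool
allFinB n p = foldr _∧_ true (map p (allFin n))

-- max { r(u,v) : u ∈ X, v ∈ V∖X }  (for X ≠ ∅, V this set is nonempty and all
-- values are ≥ 0, so taking 0 as the starting value gives the true maximum)
maxOut : ∀ {n} → Demand n → Subset n → ℕ
maxOut {n} r X =
  foldr _⊔_ 0 (map (λ { (u , v) → if X u ∧ not (X v) then b2n (r u v) else 0 }) (allPairs n))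

maxIn : ∀ {n} → Demand n → Subset n → ℕ
maxIn {n} r X =
  foldr _⊔_ 0 (map (λ { (u , v) → if X u ∧ not (X v) then b2n (r v u) else 0 }) (allPairs n))

f : ∀ {n} → Demand n → Subset n → ℕ
f {n} r X =
  if not (anyFin n X) ∨ allFinB n X then 0 else maxOut r X + maxIn r X
  where open Data.Nat using (_+_)

Orients : ∀ {n} → (Fin n × Fin n) → (Fin n × Fin n) → Set
Orients (a , b) (x , y) = (a ≡ x × b ≡ y) ⊎ (a ≡ y × b ≡ x)

IsOrientation : ∀ {n} → List (Fin n × Fin n) → Graph n → Set
IsOrientation D H = Pointwise Orients D H

Arc : ∀ {n} → List (Fin n × Fin n) → Fin n → Fin n → Set
Arc D a b = (a , b) ∈ D

-- D contains a directed u–v path (equivalently, a directed u–v walk).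
HasPath : ∀ {n} → List (Fin n × Fin n) → Fin n → Fin n → Set
HasPath D u v = Star (Arc D) u v

module Submission where

-- The hypothesis f_r ≤ d_H is only used through the cut condition: if some
-- demand leaves a set X then d_H(X) ≥ 1, and if demands cross X in both
-- directions then d_H(X) ≥ 2.  We prove by induction on the number of edges
-- that every graph satisfying the cut condition has a good orientation.
--
-- Pick an edge xy of H and grow, from x, a tree of trails in H' = H − xy.
--  * If y is reached, the trail y ⇝ x together with the arc x → y is a
--    directed cycle C.  Contracting the vertices of C to x preserves the cut
--    condition (every cut of the contraction is a cut of H not meeting C),
--    so the contracted graph with the other edges is oriented by induction;
--    paths of the contraction lift to H because C is strongly connected.
--  * Otherwise xy is a bridge cutting off the component S of x in H'.  As
--    d_H(S) = 1, demands cross S in one direction only, say never out of a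
--    side T.  Orient xy into T; the two graphs obtained from H' by
--    collapsing either side of the bridge to a point are oriented by
--    induction, and together their orientations give one of H.

open import Defs
open import Data.Nat using (ℕ; zero; suc; _+_; _≤_; _⊔_; z≤n; s≤s)
open import Data.Nat.Properties
  using (≤-trans; ≤-refl; ≤-reflexive; ≤-pred; m≤m+n; m≤m⊔n; m≤n⊔m; +-mono-≤; +-suc;
         module ≤-Reasoning)
open import Data.Nat.ListAction using (sum)
open import Data.Nat.ListAction.Properties using (sum-++; sum-↭)
open import Data.Bool using (Bool; true; false; _∧_; _∨_; not; if_then_else_)
open import Data.Bool.Properties using (T-≡; xor-same; ∧-conicalˡ; ∧-conicalʳ; not-injective; ¬-not)
open import Data.Fin using (Fin)
open import Data.Fin.Properties using (_≟_)
open import Data.Product using (Σ; ∃; ∃₂; _×_; _,_; proj₁; proj₂)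
open import Data.Sum using (_⊎_; inj₁; inj₂)
open import Data.List using (List; []; _∷_; _++_; map; foldr; allFin; length)
open import Data.List.Properties using (map-++; map-∘; length-map; length-++-≤ʳ)
open import Data.List.Membership.Propositional using (_∈_; _∉_; lose)
open import Data.List.Membership.Propositional.Properties
  using (∈-map⁺; ∈-concatMap⁺; ∈-allFin; ∈-++⁻; ∈-∃++; ∈-++⁺ˡ; ∈-++⁺ʳ)
import Data.List.Membership.DecPropositional as DecMembership
open import Data.List.Relation.Binary.Subset.Propositional using (_⊆_)
open import Data.List.Relation.Unary.Any using (here; there; satisfied)
open import Data.List.Relation.Unary.Any.Properties using (any⁺; any⁻)
open import Data.List.Relation.Unary.All as All using (All; []; _∷_)
open import Data.List.Relation.Unary.All.Properties using (all⁺)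
open import Data.List.Relation.Binary.Pointwise as Pointwise using ([]; _∷_)
open import Data.List.Relation.Binary.Permutation.Propositional as ↭ using (_↭_)
open import Data.List.Relation.Binary.Permutation.Propositional.Properties
  using (∈-resp-↭; ↭-length; shift; ++⁺ˡ; map⁺)
open import Function using (_∘_; id)
open import Function.Bundles using (Equivalence)
open import Relation.Nullary using (¬_; Dec; yes; no; does; contradiction)
open import Relation.Nullary.Decidable using (dec-true; dec-false)
open import Relation.Binary.PropositionalEquality
  using (_≡_; _≢_; refl; sym; trans; cong; subst; subst₂; ≢-sym; module ≡-Reasoning)
open import Relation.Binary.Construct.Closure.ReflexiveTransitive as Star
  using (Star; ε; _◅_; _◅◅_)

dropLoops : {A : Set} {R S : A → A → Set} →
  (∀ {a b} → R a b → a ≡ b ⊎ S a b) → ∀ {a b} → Star R a b → Star S a b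
dropLoops loopOrStep ε = ε
dropLoops loopOrStep (step ◅ path) with loopOrStep step
... | inj₁ refl = dropLoops loopOrStep path
... | inj₂ s = s ◅ dropLoops loopOrStep path

liftPath : {A B : Set} (φ : A → B) {R : B → B → Set} {S : A → A → Set} →
  (∀ {c e} → R c e → ∃₂ λ p q → S p q × φ p ≡ c × φ q ≡ e) →
  (∀ {p q} → φ p ≡ φ q → Star S p q) →
  ∀ {c e} → Star R c e → (u v : A) → φ u ≡ c → φ v ≡ e → Star S u v
liftPath φ lift fibre ε u v φu φv = fibre (trans φu (sym φv))
liftPath φ lift fibre (step ◅ path) u v φu φv with lift step
... | p , q , s , φp , φq =
  fibre (trans φu (sym φp)) ◅◅ (s ◅ liftPath φ lift fibre path q v φq φv)

-- Case distinction on a Boolean that does not rewrite the Boolean elsewhere.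
true-or-false : (b : Bool) → b ≡ true ⊎ b ≡ false
true-or-false true = inj₁ refl
true-or-false false = inj₂ refl

≤-maximum : {A : Set} (g : A → ℕ) {a : A} {L : List A} → a ∈ L → g a ≤ foldr _⊔_ 0 (map g L)
≤-maximum g (here refl) = m≤m⊔n _ _
≤-maximum g {L = b ∷ L} (there a∈L) = ≤-trans (≤-maximum g a∈L) (m≤n⊔m (g b) _)

module _ {n : ℕ} where

  open DecMembership (_≟_ {n}) using (_∈?_)

  Edge : Set
  Edge = Fin n × Fin n

  _==_ : Fin n → Fin n → Bool
  a == b = does (a ≟ b)

  ==-refl : (a : Fin n) → (a == a) ≡ true
  ==-refl a = dec-true (a ≟ a) refl

  ==-sound : {a b : Fin n} → (a == b) ≡ true → a ≡ b
  ==-sound {a} {b} eq with a ≟ b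
  ... | yes a≡b = a≡b
  ... | no _ with () ← eq

  ==-distinct : {a b : Fin n} → a ≢ b → (a == b) ≡ false
  ==-distinct {a} {b} = dec-false (a ≟ b)

  anyFin-intro : (p : Fin n → Bool) (i : Fin n) → p i ≡ true → anyFin n p ≡ true
  anyFin-intro p i pi = Equivalence.to T-≡ (any⁺ p (lose (∈-allFin i) (Equivalence.from T-≡ pi)))

  anyFin-elim : (p : Fin n → Bool) → anyFin n p ≡ true → ∃ λ i → p i ≡ true
  anyFin-elim p found with i , pi ← satisfied (any⁻ p (allFin n) (Equivalence.from T-≡ found)) =
    i , Equivalence.to T-≡ pi

  allFinB-false : (p : Fin n → Bool) (i : Fin n) → p i ≡ false → allFinB n p ≡ false
  allFinB-false p i pi = ¬-not notEverywhere
    where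
    notEverywhere : allFinB n p ≢ true
    notEverywhere everywhere =
      let everyTrue = all⁺ p (allFin n) (Equivalence.from T-≡ everywhere)
      in contradiction (trans (sym pi) (Equivalence.to T-≡ (All.lookup everyTrue (∈-allFin i)))) λ ()

  complement : Subset n → Subset n
  complement X w = not (X w)

  Leaves : Demand n → Subset n → Set
  Leaves r X = ∃₂ λ u v → r u v ≡ true × X u ≡ true × X v ≡ false

  leaves? : (r : Demand n) (X : Subset n) → Dec (Leaves r X)
  leaves? r X with anyFin n (λ u → anyFin n (λ v → X u ∧ not (X v) ∧ r u v)) in found
  ... | true
      with u , found-v ← anyFin-elim _ found
      with v , witness ← anyFin-elim _ found-v
      with Xu , rest ← ∧-conicalˡ (X u) _ witness , ∧-conicalʳ (X u) _ witness
      = yes (u , v , ∧-conicalʳ (not (X v)) _ rest , Xu ,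
             not-injective {X v} {false} (∧-conicalˡ (not (X v)) _ rest))
  ... | false = no λ { (u , v , ruv , Xu , Xv) → contradiction
          (trans (sym found) (anyFin-intro _ u (anyFin-intro _ v (witness Xu Xv ruv)))) λ () }
    where
    witness : ∀ {u v} → X u ≡ true → X v ≡ false → r u v ≡ true →
      (X u ∧ not (X v) ∧ r u v) ≡ true
    witness Xu Xv ruv rewrite Xu | Xv | ruv = refl

  CutCondition : Graph n → Demand n → Set
  CutCondition H r = (X : Subset n) → Leaves r X →
    1 ≤ d H X × (Leaves r (complement X) → 2 ≤ d H X)

  ∈-allPairs : (u v : Fin n) → (u , v) ∈ allPairs n
  ∈-allPairs u v = ∈-concatMap⁺ _ (lose (∈-allFin u) (∈-map⁺ _ (∈-allFin v)))

  maxOut-pos : {r : Demand n} {X : Subset n} → Leaves r X → 1 ≤ maxOut r X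
  maxOut-pos {r} {X} (u , v , ruv , Xu , Xv) =
    ≤-trans (≤-reflexive (sym term)) (≤-maximum _ (∈-allPairs u v))
    where
    term : (if X u ∧ not (X v) then b2n (r u v) else 0) ≡ 1
    term rewrite Xu | Xv | ruv = refl

  maxIn-pos : {r : Demand n} {X : Subset n} → Leaves r (complement X) → 1 ≤ maxIn r X
  maxIn-pos {r} {X} (u , v , ruv , ∁Xu , ∁Xv) =
    ≤-trans (≤-reflexive (sym term)) (≤-maximum _ (∈-allPairs v u))
    where
    term : (if X v ∧ not (X u) then b2n (r u v) else 0) ≡ 1
    term rewrite not-injective {X u} {false} ∁Xu | not-injective {X v} {true} ∁Xv | ruv = refl

  f-proper : (r : Demand n) (X : Subset n) {u v : Fin n} → X u ≡ true → X v ≡ false →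
    f r X ≡ maxOut r X + maxIn r X
  f-proper r X {u} {v} Xu Xv rewrite anyFin-intro X u Xu | allFinB-false X v Xv = refl

  cutCondition : {H : Graph n} {r : Demand n} → ((X : Subset n) → f r X ≤ d H X) → CutCondition H r
  cutCondition {H} {r} f≤d X out@(_ , _ , _ , Xu , Xv) =
    ≤-trans (≤-trans (maxOut-pos out) (m≤m+n _ _)) bound ,
    λ back → ≤-trans (+-mono-≤ (maxOut-pos out) (maxIn-pos back)) bound
    where
    bound : maxOut r X + maxIn r X ≤ d H X
    bound = subst (_≤ d H X) (f-proper r X Xu Xv) (f≤d X)

  d-++ : (K L : Graph n) (X : Subset n) → d (K ++ L) X ≡ d K X + d L X
  d-++ K L X = trans (cong sum (map-++ _ K L)) (sum-++ (map _ K) (map _ L))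

  d-↭ : {K L : Graph n} → K ↭ L → (X : Subset n) → d K X ≡ d L X
  d-↭ K↭L X = sum-↭ (map⁺ _ K↭L)

  mapEdge : (Fin n → Fin n) → Edge → Edge
  mapEdge φ g = φ (proj₁ g) , φ (proj₂ g)

  contract : (Fin n → Fin n) → Graph n → Graph n
  contract φ = map (mapEdge φ)

  d-contract : (φ : Fin n → Fin n) (L : Graph n) (Z : Subset n) → d (contract φ L) Z ≡ d L (Z ∘ φ)
  d-contract φ L Z = cong sum (sym (map-∘ L))

  Collapsed : {A : Set} → (Fin n → A) → Edge → Set
  Collapsed φ g = φ (proj₁ g) ≡ φ (proj₂ g)

  d-collapsed : {A : Set} (φ : Fin n → A) (Z : A → Bool) {K : Graph n} →
    All (Collapsed φ) K → d K (Z ∘ φ) ≡ 0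
  d-collapsed φ Z [] = refl
  d-collapsed φ Z {g ∷ K} (same ∷ rest) rewrite same | xor-same (Z (φ (proj₂ g))) =
    d-collapsed φ Z rest

  d-split : (φ : Fin n → Fin n) {H K L : Graph n} → H ↭ K ++ L → All (Collapsed φ) K →
    (Z : Subset n) → d H (Z ∘ φ) ≡ d (contract φ L) Z
  d-split φ {H} {K} {L} H↭ collapsed Z = begin
    d H (Z ∘ φ)                  ≡⟨ d-↭ H↭ (Z ∘ φ) ⟩
    d (K ++ L) (Z ∘ φ)           ≡⟨ d-++ K L (Z ∘ φ) ⟩
    d K (Z ∘ φ) + d L (Z ∘ φ)    ≡⟨ cong (_+ d L (Z ∘ φ)) (d-collapsed φ Z collapsed) ⟩
    d L (Z ∘ φ)                  ≡⟨ sym (d-contract φ L Z) ⟩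
    d (contract φ L) Z           ∎
    where open ≡-Reasoning

  contractDemand : (Fin n → Fin n) → Demand n → Demand n
  contractDemand φ r a b = anyFin n λ u → anyFin n λ v → (φ u == a) ∧ (φ v == b) ∧ r u v

  contractDemand-intro : (φ : Fin n → Fin n) (r : Demand n) {u v : Fin n} →
    r u v ≡ true → contractDemand φ r (φ u) (φ v) ≡ true
  contractDemand-intro φ r {u} {v} ruv = anyFin-intro _ u (anyFin-intro _ v witness)
    where
    witness : ((φ u == φ u) ∧ (φ v == φ v) ∧ r u v) ≡ true
    witness rewrite ==-refl (φ u) | ==-refl (φ v) = ruv

  contractDemand-elim : (φ : Fin n → Fin n) (r : Demand n) {a b : Fin n} →
    contractDemand φ r a b ≡ true → ∃₂ λ u v → φ u ≡ a × φ v ≡ b × r u v ≡ true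
  contractDemand-elim φ r {a} {b} found
    with u , found-v ← anyFin-elim _ found
    with v , witness ← anyFin-elim _ found-v
    with φu=a , rest ← ∧-conicalˡ (φ u == a) _ witness , ∧-conicalʳ (φ u == a) _ witness
    = u , v , ==-sound φu=a , ==-sound (∧-conicalˡ (φ v == b) _ rest) , ∧-conicalʳ (φ v == b) _ rest

  Leaves-contract : (φ : Fin n → Fin n) {r : Demand n} {Z : Subset n} →
    Leaves (contractDemand φ r) Z → Leaves r (Z ∘ φ)
  Leaves-contract φ {r} (a , b , rab , Za , Zb) with contractDemand-elim φ r rab
  ... | u , v , refl , refl , ruv = u , v , ruv , Za , Zb

  cutCondition-contract : (φ : Fin n → Fin n) {H : Graph n} (K L : Graph n) {r : Demand n} →
    H ↭ K ++ L → All (Collapsed φ) K → CutCondition H r →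
    CutCondition (contract φ L) (contractDemand φ r)
  cutCondition-contract φ K L H↭ collapsed cut Z out
    with one , two ← cut (Z ∘ φ) (Leaves-contract φ out)
    = subst (1 ≤_) same one , λ back → subst (2 ≤_) same (two (Leaves-contract φ back))
    where
    same = d-split φ H↭ collapsed Z

  LiftsTo : (Fin n → Fin n) → List Edge → List Edge → Set
  LiftsTo φ D D' = ∀ {c e} → Arc D c e → ∃₂ λ p q → Arc D' p q × φ p ≡ c × φ q ≡ e

  liftArc : (φ : Fin n → Fin n) (g : Edge) {a : Edge} → Orients a (mapEdge φ g) →
    ∃ λ a' → Orients a' g × φ (proj₁ a') ≡ proj₁ a × φ (proj₂ a') ≡ proj₂ a
  liftArc φ (x , y) (inj₁ (refl , refl)) = (x , y) , inj₁ (refl , refl) , refl , refl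
  liftArc φ (x , y) (inj₂ (refl , refl)) = (y , x) , inj₂ (refl , refl) , refl , refl

  liftOrientation : (φ : Fin n → Fin n) (L : Graph n) {D : List Edge} →
    IsOrientation D (contract φ L) → ∃ λ D' → IsOrientation D' L × LiftsTo φ D D'
  liftOrientation φ [] [] = [] , [] , λ ()
  liftOrientation φ (g ∷ L) (o ∷ os)
    with a' , o' , φc , φe ← liftArc φ g o
    with D' , os' , lifts ← liftOrientation φ L os
    = a' ∷ D' , o' ∷ os' , lifts'
    where
    lifts' : LiftsTo φ _ (a' ∷ D')
    lifts' (here refl) = _ , _ , here refl , φc , φe
    lifts' (there arc) with p , q , arc' , φp , φq ← lifts arc = p , q , there arc' , φp , φq

  orientation-↭ : {D : List Edge} {H H' : Graph n} → IsOrientation D H → H ↭ H' →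
    ∃ λ D' → IsOrientation D' H' × D ⊆ D'
  orientation-↭ {D} o ↭.refl = D , o , id
  orientation-↭ (a ∷ o) (↭.prep g H↭)
    with D' , o' , D⊆ ← orientation-↭ o H↭
    = _ ∷ D' , a ∷ o' , λ { (here eq) → here eq ; (there m) → there (D⊆ m) }
  orientation-↭ (a ∷ b ∷ o) (↭.swap g h H↭)
    with D' , o' , D⊆ ← orientation-↭ o H↭
    = _ ∷ _ ∷ D' , b ∷ a ∷ o' ,
      λ { (here eq) → there (here eq)
        ; (there (here eq)) → here eq
        ; (there (there m)) → there (there (D⊆ m)) }
  orientation-↭ o (↭.trans H↭ H↭')
    with D₁ , o₁ , D⊆D₁ ← orientation-↭ o H↭
    with D₂ , o₂ , D₁⊆D₂ ← orientation-↭ o₁ H↭'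
    = D₂ , o₂ , D₁⊆D₂ ∘ D⊆D₁

  collapse : Subset n → Fin n → Fin n → Fin n
  collapse S c w = if S w then c else w

  collapse-in : (S : Subset n) {c w : Fin n} → S w ≡ true → collapse S c w ≡ c
  collapse-in S Sw rewrite Sw = refl

  collapse-out : (S : Subset n) {c w : Fin n} → S w ≡ false → collapse S c w ≡ w
  collapse-out S Sw rewrite Sw = refl

  collapseᶜ-in : (T : Subset n) {c w : Fin n} → T w ≡ false → collapse (complement T) c w ≡ c
  collapseᶜ-in T {w = w} Tw = collapse-in (complement T) {w = w} (cong not Tw)

  collapseᶜ-out : (T : Subset n) {c w : Fin n} → T w ≡ true → collapse (complement T) c w ≡ w
  collapseᶜ-out T {w = w} Tw = collapse-out (complement T) {w = w} (cong not Tw)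

  -- Trail v x Pa Pe Vs: a walk from v to x along the arcs Pa, which orient
  -- the edges Pe, visiting the vertices Vs.
  data Trail : Fin n → Fin n → List Edge → Graph n → List (Fin n) → Set where
    stop : ∀ {x} → Trail x x [] [] (x ∷ [])
    step : ∀ {p q x Pa Pe Vs} (g : Edge) → Orients (q , p) g → Trail p x Pa Pe Vs →
      Trail q x ((q , p) ∷ Pa) (g ∷ Pe) (q ∷ Vs)

  trail-orients : ∀ {v x Pa Pe Vs} → Trail v x Pa Pe Vs → IsOrientation Pa Pe
  trail-orients stop = []
  trail-orients (step g o t) = o ∷ trail-orients t

  trail-start : ∀ {v x Pa Pe Vs} → Trail v x Pa Pe Vs → v ∈ Vs
  trail-start stop = here refl
  trail-start (step g o t) = here refl

  trail-end : ∀ {v x Pa Pe Vs} → Trail v x Pa Pe Vs → x ∈ Vs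
  trail-end stop = here refl
  trail-end (step g o t) = there (trail-end t)

  trail-reach : ∀ {v x Pa Pe Vs} → Trail v x Pa Pe Vs → {w : Fin n} → w ∈ Vs →
    HasPath Pa v w × HasPath Pa w x
  trail-reach stop (here refl) = ε , ε
  trail-reach (step g o t) (here refl) =
    ε , here refl ◅ Star.map there (proj₂ (trail-reach t (trail-start t)))
  trail-reach (step g o t) (there w∈)
    with from , to ← trail-reach t w∈
    = here refl ◅ Star.map there from , Star.map there to

  cycle-connected : ∀ {x y Pa Pe Vs} → Trail y x Pa Pe Vs → {p q : Fin n} → p ∈ Vs → q ∈ Vs →
    HasPath ((x , y) ∷ Pa) p q
  cycle-connected t p∈ q∈ =
    Star.map there (proj₂ (trail-reach t p∈))
    ◅◅ (here refl ◅ Star.map there (proj₁ (trail-reach t q∈)))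

  trail-edges : ∀ {v x Pa Pe Vs} → Trail v x Pa Pe Vs →
    All (λ g → proj₁ g ∈ Vs × proj₂ g ∈ Vs) Pe
  trail-edges stop = []
  trail-edges (step {p} {q} {Vs = Vs} g o t) =
    ends o ∷ All.map (λ (a , b) → there a , there b) (trail-edges t)
    where
    ends : Orients (q , p) g → proj₁ g ∈ q ∷ Vs × proj₂ g ∈ q ∷ Vs
    ends (inj₁ (refl , refl)) = here refl , there (trail-start t)
    ends (inj₂ (refl , refl)) = there (trail-start t) , here refl

  -- A trail from v to x through distinct edges of H: H ↭ edges ++ rest.
  record TrailIn (H : Graph n) (v x : Fin n) : Set where
    constructor trailIn
    field
      arcs : List Edge
      edges : Graph n
      visited : List (Fin n)
      rest : Graph n
      trail : Trail v x arcs edges visited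
      split : H ↭ edges ++ rest

  _⊑_ : Subset n → Subset n → Set
  S ⊑ S' = (w : Fin n) → S w ≡ true → S' w ≡ true

  insert : Fin n → Subset n → Subset n
  insert q S w = S w ∨ (w == q)

  insert-⊒ : (q : Fin n) (S : Subset n) → S ⊑ insert q S
  insert-⊒ q S w Sw rewrite Sw = refl

  insert-new : (q : Fin n) (S : Subset n) → insert q S q ≡ true
  insert-new q S rewrite ==-refl q with S q
  ... | true = refl
  ... | false = refl

  outside : Subset n → List (Fin n) → ℕ
  outside S L = sum (map (λ w → b2n (not (S w))) L)

  outside-vertex : {S S' : Subset n} → S ⊑ S' → (w : Fin n) → b2n (not (S' w)) ≤ b2n (not (S w))
  outside-vertex {S} {S'} S⊑ w with S w in Sw | S' w in S'w
  ... | false | true = z≤n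
  ... | false | false = ≤-refl
  ... | true | true = z≤n
  ... | true | false with () ← trans (sym S'w) (S⊑ w Sw)

  outside-mono : {S S' : Subset n} → S ⊑ S' → (L : List (Fin n)) → outside S' L ≤ outside S L
  outside-mono S⊑ [] = z≤n
  outside-mono S⊑ (w ∷ L) = +-mono-≤ (outside-vertex S⊑ w) (outside-mono S⊑ L)

  outside-strict : {S S' : Subset n} → S ⊑ S' → {q : Fin n} → S q ≡ false → S' q ≡ true →
    {L : List (Fin n)} → q ∈ L → suc (outside S' L) ≤ outside S L
  outside-strict S⊑ Sq S'q {_ ∷ L} (here refl) rewrite Sq | S'q = s≤s (outside-mono S⊑ L)
  outside-strict S⊑ Sq S'q {w ∷ L} (there q∈) =
    ≤-trans (≤-reflexive (sym (+-suc _ _)))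
            (+-mono-≤ (outside-vertex S⊑ w) (outside-strict S⊑ Sq S'q q∈))

  Crossing : Subset n → Edge → Set
  Crossing S g = ∃₂ λ p q → S p ≡ true × S q ≡ false × Orients (q , p) g

  crossing? : (S : Subset n) (g : Edge) → Crossing S g ⊎ Collapsed S g
  crossing? S (a , b) with S a in Sa | S b in Sb
  ... | true | false = inj₁ (a , b , Sa , Sb , inj₂ (refl , refl))
  ... | false | true = inj₁ (b , a , Sb , Sa , inj₁ (refl , refl))
  ... | true | true = inj₂ refl
  ... | false | false = inj₂ refl

  crossingEdge : (S : Subset n) (L : Graph n) →
    (∃ λ g → g ∈ L × Crossing S g) ⊎ All (Collapsed S) L
  crossingEdge S [] = inj₂ []
  crossingEdge S (g ∷ L) with crossing? S g | crossingEdge S L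
  ... | inj₁ cross | _ = inj₁ (g , here refl , cross)
  ... | inj₂ closed | inj₁ (h , h∈ , cross) = inj₁ (h , there h∈ , cross)
  ... | inj₂ closed | inj₂ closeds = inj₂ (closed ∷ closeds)

  module Growth (x y : Fin n) (H' : Graph n) where

    Inside : Subset n → Edge → Set
    Inside S g = S (proj₁ g) ≡ true × S (proj₂ g) ≡ true

    TrailInside : Subset n → Fin n → Set
    TrailInside S v = Σ (TrailIn H' v x) λ t → All (Inside S) (TrailIn.edges t)

    Outcome : Set
    Outcome = TrailIn H' y x ⊎ ∃ λ S → S x ≡ true × S y ≡ false × All (Collapsed S) H'

    tail-inside : ∀ {S g q p} → Orients (q , p) g → Inside S g → S q ≡ true
    tail-inside (inj₁ (refl , refl)) (Sq , _) = Sq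
    tail-inside (inj₂ (refl , refl)) (_ , Sq) = Sq

    widen : (S : Subset n) (q : Fin n) {g : Edge} → Inside S g → Inside (insert q S) g
    widen S q (a , b) = insert-⊒ q S _ a , insert-⊒ q S _ b

    shrinks : (S : Subset n) (q : Fin n) → S q ≡ false →
      suc (outside (insert q S) (allFin n)) ≤ outside S (allFin n)
    shrinks S q Sq = outside-strict (insert-⊒ q S) Sq (insert-new q S) (∈-allFin q)

    -- A crossing edge from p ∈ S to q ∉ S is not yet used by the trail of p,
    -- so it extends this trail to a trail of q inside S ∪ {q}.
    extend : (S : Subset n) (g : Edge) → g ∈ H' → (p q : Fin n) → S p ≡ true → S q ≡ false →
      Orients (q , p) g → TrailInside S p → TrailInside (insert q S) q
    extend S g g∈ p q Sp Sq o (trailIn Pa Pe Vs rest t split , inside)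
      with ∈-++⁻ Pe (∈-resp-↭ split g∈)
    ... | inj₁ g∈Pe with () ← trans (sym Sq) (tail-inside o (All.lookup inside g∈Pe))
    ... | inj₂ g∈rest with ys , zs , refl ← ∈-∃++ g∈rest =
      trailIn _ _ _ (ys ++ zs) (step g o t) split' , ends o ∷ All.map (widen S q) inside
      where
      split' : H' ↭ g ∷ Pe ++ ys ++ zs
      split' = ↭.trans split (↭.trans (++⁺ˡ Pe (shift g ys zs)) (shift g Pe (ys ++ zs)))
      ends : Orients (q , p) g → Inside (insert q S) g
      ends (inj₁ (refl , refl)) = insert-new q S , insert-⊒ q S p Sp
      ends (inj₂ (refl , refl)) = insert-⊒ q S p Sp , insert-new q S

    -- The fuel k bounds the number of vertices outside S.
    grow : (k : ℕ) (S : Subset n) → outside S (allFin n) ≤ k → S x ≡ true →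
      ((v : Fin n) → S v ≡ true → TrailInside S v) → Outcome
    grow k S bound Sx trails with S y in Sy
    ... | true = inj₁ (proj₁ (trails y Sy))
    ... | false with crossingEdge S H' | k
    ...   | inj₂ closed | _ = inj₂ (S , Sx , Sy , closed)
    ...   | inj₁ (_ , _ , _ , q , _ , Sq , _) | zero with () ← ≤-trans (shrinks S q Sq) bound
    ...   | inj₁ (g , g∈ , p , q , Sp , Sq , o) | suc k' =
      grow k' (insert q S) bound' (insert-⊒ q S x Sx) trails'
      where
      bound' : outside (insert q S) (allFin n) ≤ k'
      bound' = ≤-pred (≤-trans (shrinks S q Sq) bound)
      trails' : (v : Fin n) → insert q S v ≡ true → TrailInside (insert q S) v
      trails' v Sv with S v in old
      ... | true with trail , inside ← trails v old = trail , All.map (widen S q) inside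
      ... | false with refl ← ==-sound {v} {q} Sv = extend S g g∈ p q Sp Sq o (trails p Sp)

    start : Outcome
    start = grow _ (_== x) ≤-refl (==-refl x) trivial
      where
      trivial : (v : Fin n) → (v == x) ≡ true → TrailInside (_== x) v
      trivial v v=x with refl ← ==-sound {v} {x} v=x = trailIn [] [] (x ∷ []) H' stop ↭.refl , []

  record GoodOrientation (H : Graph n) (r : Demand n) : Set where
    constructor good
    field
      arcs : List Edge
      orients : IsOrientation arcs H
      connects : (u v : Fin n) → r u v ≡ true → HasPath arcs u v

  UpTo : ℕ → Set
  UpTo k = (H : Graph n) → length H ≤ k → (r : Demand n) → CutCondition H r → GoodOrientation H r

  -- Without edges, the cut condition forces every demand to be a loop.
  noEdges : (r : Demand n) → CutCondition [] r → GoodOrientation [] r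
  noEdges r cut = good [] [] connects
    where
    connects : (u v : Fin n) → r u v ≡ true → HasPath [] u v
    connects u v ruv with u ≟ v
    ... | yes refl = ε
    ... | no u≢v with () ← proj₁ (cut (_== u) (u , v , ruv , ==-refl u , ==-distinct (≢-sym u≢v)))

  cycleCase : {k : ℕ} → UpTo k → (x y : Fin n) (H' : Graph n) → length H' ≤ k →
    (r : Demand n) → CutCondition ((x , y) ∷ H') r → TrailIn H' y x →
    GoodOrientation ((x , y) ∷ H') r
  cycleCase {k} ih x y H' len r cut (trailIn Pa Pe Vs rest t split) =
    liftCycle (ih (contract φ rest) smaller (contractDemand φ r)
                  (cutCondition-contract φ ((x , y) ∷ Pe) rest (↭.prep (x , y) split)
                                         cycleCollapsed cut))
    where
    onCycle? : Subset n
    onCycle? w = does (w ∈? Vs)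

    φ : Fin n → Fin n
    φ = collapse onCycle? x

    onCycle : {w : Fin n} → w ∈ Vs → φ w ≡ x
    onCycle {w} w∈ = collapse-in onCycle? (dec-true (w ∈? Vs) w∈)

    offCycle : {w : Fin n} → w ∉ Vs → φ w ≡ w
    offCycle {w} w∉ = collapse-out onCycle? (dec-false (w ∈? Vs) w∉)

    toCycle : {w : Fin n} → φ w ≡ x → w ∈ Vs
    toCycle {w} φw≡x = byMembership (w ∈? Vs)
      where
      byMembership : Dec (w ∈ Vs) → w ∈ Vs
      byMembership (yes w∈) = w∈
      byMembership (no w∉) = subst (_∈ Vs) (trans (sym φw≡x) (offCycle w∉)) (trail-end t)

    cycleCollapsed : All (Collapsed φ) ((x , y) ∷ Pe)
    cycleCollapsed = trans (onCycle (trail-end t)) (sym (onCycle (trail-start t)))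
      ∷ All.map (λ (a , b) → trans (onCycle a) (sym (onCycle b))) (trail-edges t)

    smaller : length (contract φ rest) ≤ k
    smaller = begin
      length (contract φ rest) ≡⟨ length-map _ rest ⟩
      length rest              ≤⟨ length-++-≤ʳ rest {Pe} ⟩
      length (Pe ++ rest)      ≡⟨ sym (↭-length split) ⟩
      length H'                ≤⟨ len ⟩
      k                        ∎
      where open ≤-Reasoning

    liftCycle : GoodOrientation (contract φ rest) (contractDemand φ r) →
      GoodOrientation ((x , y) ∷ H') r
    liftCycle (good D₀ o₀ connects₀)
      with DL , oL , lifts ← liftOrientation φ rest o₀
      with D , oD , D⊇ ← orientation-↭ {D = (x , y) ∷ Pa ++ DL}
                           (inj₁ (refl , refl) ∷ Pointwise.++⁺ (trail-orients t) oL)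
                           (↭.↭-sym (↭.prep (x , y) split))
      = good D oD connects
      where
      cycleArcs : (x , y) ∷ Pa ⊆ D
      cycleArcs (here eq) = D⊇ (here eq)
      cycleArcs (there arc) = D⊇ (there (∈-++⁺ˡ arc))

      -- Vertices with the same image are both on the cycle, or equal.
      fibre : ∀ {p q} → φ p ≡ φ q → HasPath D p q
      fibre {p} {q} same = byMembership (p ∈? Vs) (q ∈? Vs)
        where
        byMembership : Dec (p ∈ Vs) → Dec (q ∈ Vs) → HasPath D p q
        byMembership (yes p∈) _ =
          Star.map cycleArcs (cycle-connected t p∈ (toCycle (trans (sym same) (onCycle p∈))))
        byMembership (no p∉) (yes q∈) = contradiction (toCycle (trans same (onCycle q∈))) p∉
        byMembership (no p∉) (no q∉) =
          subst (HasPath D p) (trans (sym (offCycle p∉)) (trans same (offCycle q∉))) ε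

      lifts' : LiftsTo φ D₀ D
      lifts' arc with p , q , arc' , φp , φq ← lifts arc =
        p , q , D⊇ (there (∈-++⁺ʳ Pa arc')) , φp , φq

      connects : (u v : Fin n) → r u v ≡ true → HasPath D u v
      connects u v ruv =
        liftPath φ lifts' fibre (connects₀ (φ u) (φ v) (contractDemand-intro φ r ruv)) u v refl refl

  _⊆°_ : List Edge → List Edge → Set
  D ⊆° D' = ∀ {a b} → Arc D a b → a ≡ b ⊎ Arc D' a b

  ⊆°-keep : ∀ {g D₀ D} → D₀ ⊆° D → (g ∷ D₀) ⊆° (g ∷ D)
  ⊆°-keep D₀⊆ (here refl) = inj₂ (here refl)
  ⊆°-keep D₀⊆ (there arc) with D₀⊆ arc
  ... | inj₁ eq = inj₁ eq
  ... | inj₂ arc' = inj₂ (there arc')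

  ⊆°-loop : ∀ {c e g D₀ D} → c ≡ e → D₀ ⊆° D → ((c , e) ∷ D₀) ⊆° (g ∷ D)
  ⊆°-loop c≡e D₀⊆ (here refl) = inj₁ c≡e
  ⊆°-loop c≡e D₀⊆ (there arc) with D₀⊆ arc
  ... | inj₁ eq = inj₁ eq
  ... | inj₂ arc' = inj₂ (there arc')

  loopArc : {c e s t : Fin n} → Orients (c , e) (s , t) → s ≡ t → c ≡ e
  loopArc (inj₁ (refl , refl)) refl = refl
  loopArc (inj₂ (refl , refl)) refl = refl

  -- Orientations of the two graphs obtained from L by collapsing either side
  -- of a cut T that no edge of L crosses combine to an orientation of L:
  -- each edge keeps the arc it receives on the side where it is not a loop.
  merge : (T : Subset n) (c₁ c₂ : Fin n) (L : Graph n) → All (Collapsed T) L →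
    {D₁ D₂ : List Edge} →
    IsOrientation D₁ (contract (collapse (complement T) c₁) L) →
    IsOrientation D₂ (contract (collapse T c₂) L) →
    ∃ λ D → IsOrientation D L × D₁ ⊆° D × D₂ ⊆° D
  merge T c₁ c₂ [] [] [] [] = [] , [] , (λ ()) , (λ ())
  merge T c₁ c₂ ((a , b) ∷ L) (closed ∷ closeds) (o₁ ∷ os₁) (o₂ ∷ os₂)
    with D , o , D₁⊆ , D₂⊆ ← merge T c₁ c₂ L closeds os₁ os₂
    with true-or-false (T a)
  ... | inj₁ Ta = _ ∷ D , kept o₁ ∷ o , ⊆°-keep D₁⊆ , ⊆°-loop (loopArc o₂ collapsed) D₂⊆
    where
    Tb : T b ≡ true
    Tb = trans (sym closed) Ta
    collapsed : collapse T c₂ a ≡ collapse T c₂ b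
    collapsed = trans (collapse-in T Ta) (sym (collapse-in T Tb))
    kept : ∀ {arc} → Orients arc (collapse (complement T) c₁ a , collapse (complement T) c₁ b) →
      Orients arc (a , b)
    kept = subst₂ (λ s t → Orients _ (s , t)) (collapseᶜ-out T Ta) (collapseᶜ-out T Tb)
  ... | inj₂ Ta = _ ∷ D , kept o₂ ∷ o , ⊆°-loop (loopArc o₁ collapsed) D₁⊆ , ⊆°-keep D₂⊆
    where
    Tb : T b ≡ false
    Tb = trans (sym closed) Ta
    collapsed : collapse (complement T) c₁ a ≡ collapse (complement T) c₁ b
    collapsed = trans (collapseᶜ-in T Ta) (sym (collapseᶜ-in T Tb))
    kept : ∀ {arc} → Orients arc (collapse T c₂ a , collapse T c₂ b) → Orients arc (a , b)
    kept = subst₂ (λ s t → Orients _ (s , t)) (collapse-out T Ta) (collapse-out T Tb)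

  bridgeInto : {k : ℕ} → UpTo k → (x y : Fin n) (H' : Graph n) → length H' ≤ k →
    (r : Demand n) → CutCondition ((x , y) ∷ H') r →
    (T : Subset n) (p q : Fin n) → T p ≡ false → T q ≡ true → Orients (p , q) (x , y) →
    All (Collapsed T) H' → ¬ Leaves r T → GoodOrientation ((x , y) ∷ H') r
  bridgeInto ih x y H' len r cut T p q Tp Tq pq closed noneLeave =
    combine (side φ₁ (trans (collapseᶜ-in T Tp) (sym (collapseᶜ-out T Tq))))
            (side φ₂ (trans (collapse-out T Tp) (sym (collapse-in T Tq))))
    where
    φ₁ φ₂ : Fin n → Fin n
    φ₁ = collapse (complement T) q
    φ₂ = collapse T p

    side : (φ : Fin n → Fin n) → φ p ≡ φ q → GoodOrientation (contract φ H') (contractDemand φ r)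
    side φ φp≡φq =
      ih (contract φ H') (≤-trans (≤-reflexive (length-map _ H')) len) (contractDemand φ r)
         (cutCondition-contract φ ((x , y) ∷ []) H' ↭.refl (loopEdge pq ∷ []) cut)
      where
      loopEdge : Orients (p , q) (x , y) → Collapsed φ (x , y)
      loopEdge (inj₁ (refl , refl)) = φp≡φq
      loopEdge (inj₂ (refl , refl)) = sym φp≡φq

    combine : GoodOrientation (contract φ₁ H') (contractDemand φ₁ r) →
              GoodOrientation (contract φ₂ H') (contractDemand φ₂ r) →
              GoodOrientation ((x , y) ∷ H') r
    combine (good D₁ o₁ connects₁) (good D₂ o₂ connects₂)
      with D , oD , D₁⊆ , D₂⊆ ← merge T q p H' closed o₁ o₂
      = good ((p , q) ∷ D) (pq ∷ oD) connects
      where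
      via : (φ : Fin n → Fin n) {D₀ : List Edge} → D₀ ⊆° D →
        ((a b : Fin n) → contractDemand φ r a b ≡ true → HasPath D₀ a b) →
        {u v : Fin n} → r u v ≡ true → HasPath ((p , q) ∷ D) (φ u) (φ v)
      via φ D₀⊆ connects₀ ruv =
        Star.map there (dropLoops D₀⊆ (connects₀ _ _ (contractDemand-intro φ r ruv)))

      -- Demands inside T use the first graph, demands outside T the second,
      -- and demands entering T run through the bridge p → q.
      connects : (u v : Fin n) → r u v ≡ true → HasPath ((p , q) ∷ D) u v
      connects u v ruv with T u in Tu | T v in Tv
      ... | true | true =
        subst₂ (HasPath _) (collapseᶜ-out T Tu) (collapseᶜ-out T Tv) (via φ₁ D₁⊆ connects₁ ruv)
      ... | false | false =
        subst₂ (HasPath _) (collapse-out T Tu) (collapse-out T Tv) (via φ₂ D₂⊆ connects₂ ruv)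
      ... | false | true =
        subst₂ (HasPath _) (collapse-out T Tu) (collapse-in T Tv) (via φ₂ D₂⊆ connects₂ ruv)
        ◅◅ (here refl ◅ subst₂ (HasPath _) (collapseᶜ-in T Tu) (collapseᶜ-out T Tv)
                                           (via φ₁ D₁⊆ connects₁ ruv))
      ... | true | false = contradiction (u , v , ruv , Tu , Tv) noneLeave

  d-bridge : {x y : Fin n} {H' : Graph n} {S : Subset n} → S x ≡ true → S y ≡ false →
    All (Collapsed S) H' → d ((x , y) ∷ H') S ≡ 1
  d-bridge {S = S} Sx Sy closed rewrite Sx | Sy = cong suc (d-collapsed S id closed)

  -- Case 2: the edge xy is a bridge leaving the closed set S ∋ x.  As
  -- d_H(S) = 1, the cut condition forbids demands crossing S both ways.
  bridgeCase : {k : ℕ} → UpTo k → (x y : Fin n) (H' : Graph n) → length H' ≤ k →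
    (r : Demand n) → CutCondition ((x , y) ∷ H') r →
    (S : Subset n) → S x ≡ true → S y ≡ false → All (Collapsed S) H' →
    GoodOrientation ((x , y) ∷ H') r
  bridgeCase ih x y H' len r cut S Sx Sy closed with leaves? r S | leaves? r (complement S)
  ... | no noneLeave | _ =
    bridgeInto ih x y H' len r cut S y x Sy Sx (inj₂ (refl , refl)) closed noneLeave
  ... | yes _ | no noneEnter =
    bridgeInto ih x y H' len r cut (complement S) x y (cong not Sx) (cong not Sy) (inj₁ (refl , refl))
      (All.map (cong not) closed) noneEnter
  ... | yes out | yes back with s≤s () ← subst (2 ≤_) (d-bridge Sx Sy closed) (proj₂ (cut S out) back)

  orient : (k : ℕ) → UpTo k
  orient k [] _ r cut = noEdges r cut
  orient (suc k) ((x , y) ∷ H') (s≤s len) r cut with Growth.start x y H'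
  ... | inj₁ cycle = cycleCase (orient k) x y H' len r cut cycle
  ... | inj₂ (S , Sx , Sy , closed) = bridgeCase (orient k) x y H' len r cut S Sx Sy closed

-- The theorem.
lemma2 : (n : ℕ) (r : Demand n) (H : Graph n)
    → ∃ (λ u → ∃ (λ v → r u v ≡ true))
    → ((X : Subset n) → f r X ≤ d H X)
    → Σ (List (Fin n × Fin n)) (λ D →
    IsOrientation D H × ((u v : Fin n) → r u v ≡ true → HasPath D u v))
lemma2 n r H _ f≤d
  with good D orients connects ← orient (length H) H ≤-refl r (cutCondition {H = H} f≤d)
  = D , orients , connects
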